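{- Let $n\ge1$ and let $w,u\in S_n$ satisfy $\operatorname{Des}(u)\subseteq\operatorname{LRM}'(w)$. Then $uw\le_{\mathrm{lex}}w$.
   Context: $S_n$ is the symmetric group on $[n]$, with product given by composition: $(uw)(i)=u(w(i))$. $\operatorname{Des}(u)=\{i\in[n-1]\mid u(i)>u(i+1)\}$. The left-to-right minima of $w$ are $\operatorname{LRM}(w)=\{i\in[n]\mid w(k)>i\text{ for all }k<w^{ -1}(i)\}$, and $\operatorname{LRM}'(w)=\{\ell-1\mid \ell\in\operatorname{LRM}(w),\ \ell>1\}\subseteq[n-1]$. $\le_{\mathrm{lex}}$ is the lexicographic order on permutations viewed as their one-line notations $(w(1),\dots,w(n))$. -}

module Defs where

open import Data.Nat using (ℕ; suc; _<_; _>_; _≤_)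
open import Data.Fin using (Fin; toℕ)
open import Data.Fin.Permutation using (Permutation′; _⟨$⟩ʳ_; _⟨$⟩ˡ_; _∘ₚ_)
open import Data.Product using (Σ; _×_; ∃)
open import Data.Sum using (_⊎_)
open import Relation.Binary.PropositionalEquality using (_≡_)

-- Convention: S_n is realised as Permutation′ n, acting on Fin n = {0,…,n-1};
-- paper's value/position i ∈ [n] corresponds to Fin-element i-1.

val : ∀ {n} → Permutation′ n → Fin n → ℕ
val w i = suc (toℕ (w ⟨$⟩ʳ i))

InDes : ∀ {n} → Permutation′ n → ℕ → Set
InDes {n} u d = Σ (Fin n) λ i → Σ (Fin n) λ j →
  (suc (toℕ i) ≡ d) × (suc (toℕ j) ≡ suc d) × (val u i > val u j)

InLRM : ∀ {n} → Permutation′ n → ℕ → Set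
InLRM {n} w ℓ = Σ (Fin n) λ v → (suc (toℕ v) ≡ ℓ) ×
  ((k : Fin n) → toℕ k < toℕ (w ⟨$⟩ˡ v) → val w k > ℓ)

InLRM′ : ∀ {n} → Permutation′ n → ℕ → Set
InLRM′ w d = InLRM w (suc d) × (suc d > 1)

DesSubLRM′ : ∀ {n} → Permutation′ n → Permutation′ n → Set
DesSubLRM′ u w = ∀ d → InDes u d → InLRM′ w d

-- product uw = u ∘ w : (uw)(i) = u(w(i))
_·_ : ∀ {n} → Permutation′ n → Permutation′ n → Permutation′ n
u · w = w ∘ₚ u

_≤lex_ : ∀ {n} → Permutation′ n → Permutation′ n → Set
_≤lex_ {n} x y = ((i : Fin n) → val x i ≡ val y i) ⊎
  (Σ (Fin n) λ p → ((k : Fin n) → toℕ k < toℕ p → val x k ≡ val y k) × (val x p < val y p))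

{-# OPTIONS --safe #-}
module Submission where

-- Let p be the first position where uw and w differ, so u fixes w(k) for k < p, and
-- suppose u(x) > x for x = w(p).  Then u(y) > x for all y ≥ x: passing from y to y + 1,
-- either u increases, or u has a descent at y, so y + 1 ∈ LRM(w); being larger than
-- w(p), that left-to-right minimum occurs before p and is fixed by u.  Hence u⁻¹ maps
-- {0, …, x} injectively into {0, …, x - 1}, which is impossible.

open import Defs
open import Data.Nat as ℕ using (ℕ; zero; suc; _≥_; s≤s; s≤s⁻¹)
import Data.Nat.Properties as ℕₚ
open import Data.Fin as Fin using (Fin; toℕ; fromℕ<; inject₁; inject≤; _≤_; _<_)
open import Data.Fin.Properties
  using (toℕ-injective; toℕ<n; toℕ-inject; toℕ-inject₁; toℕ-inject≤; toℕ-fromℕ<;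
         inject≤-injective; fromℕ<-injective; injective⇒≤; ¬∀⟶∃¬-smallest; all?;
         _≟_; _<?_; <-cmp; <-irrefl; <-asym; ≤∧≢⇒<)
open import Data.Fin.Induction using (<-weakInduction-startingFrom)
open import Data.Fin.Permutation using (Permutation′; _⟨$⟩ʳ_; _⟨$⟩ˡ_; flip; inverseʳ)
open import Data.Product using (_,_)
open import Data.Sum using (inj₁; inj₂)
open import Data.Empty using (⊥-elim)
open import Function using (_∘_; Injection)
open import Function.Definitions using (Injective)
open import Function.Properties.Inverse using (↔⇒↣)
open import Relation.Nullary using (¬_; yes; no)
open import Relation.Unary using (Pred)
open import Relation.Binary.PropositionalEquality using (_≡_; refl; sym; trans; cong; subst)
open import Relation.Binary.Definitions using (tri<; tri≈; tri>)

private variable n : ℕ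

injective⇒¬maps-≤-into-< : (f : Fin n → Fin n) → Injective _≡_ _≡_ f →
                            (x : Fin n) → ¬ (∀ v → v ≤ x → f v < x)
injective⇒¬maps-≤-into-< {n} f f-injective x f[≤x]<x =
  ℕₚ.<-irrefl refl (injective⇒≤ g-injective)
  where
  embed : Fin (suc (toℕ x)) → Fin n
  embed v = inject≤ v (toℕ<n x)

  embed≤x : ∀ v → embed v ≤ x
  embed≤x v = subst (ℕ._≤ toℕ x) (sym (toℕ-inject≤ v _)) (s≤s⁻¹ (toℕ<n v))

  g : Fin (suc (toℕ x)) → Fin (toℕ x)
  g v = fromℕ< (f[≤x]<x (embed v) (embed≤x v))

  g-injective : Injective _≡_ _≡_ g
  g-injective g≡ = inject≤-injective _ _ _ _
    (f-injective (toℕ-injective (fromℕ<-injective _ _ _ _ g≡)))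

<-weakInduction-above : ∀ {ℓ} (P : Pred (Fin (suc n)) ℓ) {i} → P i →
                        (∀ j → i ≤ inject₁ j → P (inject₁ j) → P (Fin.suc j)) →
                        ∀ {j} → i ≤ j → P j
<-weakInduction-above P {i} Pᵢ step i≤j =
  <-weakInduction-startingFrom (λ j → i ≤ j → P j) (λ _ → Pᵢ) step′ i≤j i≤j
  where
  step′ : ∀ j → (i ≤ inject₁ j → P (inject₁ j)) → i ≤ Fin.suc j → P (Fin.suc j)
  step′ k P[k] i≤1+k with ℕₚ.m≤n⇒m<n∨m≡n i≤1+k
  ... | inj₁ (s≤s i≤k) = step k i≤inject₁k (P[k] i≤inject₁k)
    where i≤inject₁k = subst (toℕ i ℕ.≤_) (sym (toℕ-inject₁ k)) i≤k
  ... | inj₂ i≡1+k     = subst P (toℕ-injective i≡1+k) Pᵢ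

-- IsLRMValue w y is InLRM w (suc (toℕ y)).
IsLRMValue : Permutation′ n → Fin n → Set
IsLRMValue w y = ∀ k → k < w ⟨$⟩ˡ y → y < w ⟨$⟩ʳ k

-- A descent of u at positions i, i + 1 is the descent d = i + 1 of the paper, and
-- d ∈ LRM′(w) says that the value d + 1, that is j in 0-indexed form, is in LRM(w).
descent⇒isLRMValue : (u w : Permutation′ n) → DesSubLRM′ u w →
                     ∀ {i j} → toℕ j ≡ suc (toℕ i) → u ⟨$⟩ʳ j < u ⟨$⟩ʳ i → IsLRMValue w j
descent⇒isLRMValue u w des⊆lrm {i} {j} j≡1+i uj<ui
  with des⊆lrm (suc (toℕ i)) (i , j , refl , cong suc j≡1+i , s≤s uj<ui)
... | (v , 1+v≡2+i , v-lrm) , _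
  with toℕ-injective {i = v} {j} (trans (ℕₚ.suc-injective 1+v≡2+i) (sym j≡1+i))
... | refl = λ k k<w⁻¹j →
  subst (ℕ._< toℕ (w ⟨$⟩ʳ k)) (sym j≡1+i) (s≤s⁻¹ (v-lrm k k<w⁻¹j))

isLRMValue⇒before : (w : Permutation′ n) {y : Fin n} (p : Fin n) →
                    IsLRMValue w y → w ⟨$⟩ʳ p < y → w ⟨$⟩ˡ y < p
isLRMValue⇒before w {y} p y-lrm wp<y with <-cmp (w ⟨$⟩ˡ y) p
... | tri< w⁻¹y<p _ _ = w⁻¹y<p
... | tri≈ _ refl _   = ⊥-elim (<-irrefl (inverseʳ w) wp<y)
... | tri> _ _ p<w⁻¹y = ⊥-elim (<-asym wp<y (y-lrm p p<w⁻¹y))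

fixed-before⇒≤ : (u w : Permutation′ n) → DesSubLRM′ u w → ∀ p →
                 (∀ k → k < p → u ⟨$⟩ʳ (w ⟨$⟩ʳ k) ≡ w ⟨$⟩ʳ k) →
                 u ⟨$⟩ʳ (w ⟨$⟩ʳ p) ≤ w ⟨$⟩ʳ p
fixed-before⇒≤ {zero} _ _ _ () _
fixed-before⇒≤ {suc n} u w des⊆lrm p fixed = ℕₚ.≮⇒≥ λ x<ux →
  injective⇒¬maps-≤-into-< (u ⟨$⟩ˡ_) u⁻¹-injective x λ v v≤x →
    ℕₚ.≰⇒> λ x≤u⁻¹v → ℕₚ.<⇒≱ (subst (x <_) (inverseʳ u) (above x<ux x≤u⁻¹v)) v≤x
  where
  x = w ⟨$⟩ʳ p

  u⁻¹-injective : Injective _≡_ _≡_ (u ⟨$⟩ˡ_)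
  u⁻¹-injective = Injection.injective (↔⇒↣ (flip u))

  fixed-if-before : ∀ y → w ⟨$⟩ˡ y < p → u ⟨$⟩ʳ y ≡ y
  fixed-if-before y w⁻¹y<p = subst (λ z → u ⟨$⟩ʳ z ≡ z) (inverseʳ w) (fixed _ w⁻¹y<p)

  step : ∀ j → x ≤ inject₁ j → x < u ⟨$⟩ʳ inject₁ j → x < u ⟨$⟩ʳ Fin.suc j
  step j x≤j x<uj with u ⟨$⟩ʳ Fin.suc j <? u ⟨$⟩ʳ inject₁ j
  ... | no ¬descent = ℕₚ.<-≤-trans x<uj (ℕₚ.≮⇒≥ ¬descent)
  ... | yes descent = subst (x <_) (sym (fixed-if-before _ before-p)) x<1+j
    where
    x<1+j : x < Fin.suc j
    x<1+j = s≤s (subst (toℕ x ℕ.≤_) (toℕ-inject₁ j) x≤j)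

    before-p : w ⟨$⟩ˡ Fin.suc j < p
    before-p = isLRMValue⇒before w p
      (descent⇒isLRMValue u w des⊆lrm {inject₁ j} (cong suc (sym (toℕ-inject₁ j))) descent) x<1+j

  above : x < u ⟨$⟩ʳ x → ∀ {y} → x ≤ y → x < u ⟨$⟩ʳ y
  above x<ux = <-weakInduction-above (λ y → x < u ⟨$⟩ʳ y) x<ux step

≤-at-first-difference⇒≤lex : (x y : Permutation′ n) →
  (∀ p → (∀ k → k < p → x ⟨$⟩ʳ k ≡ y ⟨$⟩ʳ k) → x ⟨$⟩ʳ p ≤ y ⟨$⟩ʳ p) → x ≤lex y
≤-at-first-difference⇒≤lex {n} x y ≤-at-first with all? (λ k → x ⟨$⟩ʳ k ≟ y ⟨$⟩ʳ k)
... | yes agree = inj₁ (λ k → cong (suc ∘ toℕ) (agree k))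
... | no ¬agree with ¬∀⟶∃¬-smallest n _ (λ k → x ⟨$⟩ʳ k ≟ y ⟨$⟩ʳ k) ¬agree
...   | p , xp≢yp , agree-before = inj₂ (p , (λ k k<p → cong (suc ∘ toℕ) (agree-below k k<p)) ,
                                     s≤s (≤∧≢⇒< (≤-at-first p agree-below) xp≢yp))
  where
  agree-below : ∀ k → k < p → x ⟨$⟩ʳ k ≡ y ⟨$⟩ʳ k
  agree-below k k<p = subst (λ k → x ⟨$⟩ʳ k ≡ y ⟨$⟩ʳ k)
    (toℕ-injective (trans (toℕ-inject (fromℕ< k<p)) (toℕ-fromℕ< k<p))) (agree-before (fromℕ< k<p))

lemma3p4 : (n : ℕ) → n ≥ 1 → (w u : Permutation′ n) →
    DesSubLRM′ u w → (u · w) ≤lex w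
lemma3p4 n _ w u des⊆lrm = ≤-at-first-difference⇒≤lex (u · w) w (fixed-before⇒≤ u w des⊆lrm)
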